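{- Let $\varphi$ be an inequality formula with $\mathrm{Var}(\varphi)=\{x_1,\ldots,x_n\}$, let $\chi$ be a constant of sort $\mathbb{Z}$ not occurring in $\varphi$, and let the sets $\mathcal{B}^\varphi_{x}$ be as defined in the context. Consider $(\alpha)\quad \exists x_1\cdots\exists x_n.\ \varphi$ and $(\beta)\quad \bigvee_{s_1\in\mathcal{B}^\varphi_{x_1}}\cdots\bigvee_{s_n\in\mathcal{B}^\varphi_{x_n}} \varphi\{x_i\leftarrow s_i \mid i=1,\ldots,n\}$. Let $I$ be a $\mathbb{Z}$-interpretation of $(\alpha)$ and let $G$ be a set of ground terms containing all ground terms occurring in $\varphi$. Then $I\models(\alpha)$ if and only if every extension $J$ of $I$ to the constant $\chi$ (as a $\mathbb{Z}$-interpretation) satisfies $\left(\bigwedge_{t\in G}\neg(\chi\le t)\right)\Rightarrow(\beta)$.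
   Context: Terms of sort $\mathbb{Z}$ are built from integer variables, $0$, unary $-$, binary $+$ and possibly other function symbols of range $\mathbb{Z}$ (all of whose arguments are of sort $\mathbb{Z}$). A $\mathbb{Z}$-interpretation interprets sort $\mathbb{Z}$ as the integers and $0,-,+$ as usual, and $\le$ as the usual order. An inequality formula is a formula $\varphi=\bigwedge_{i=1}^m s_i\le t_i$ where each $s_i$ and each $t_i$ is either a ground integer term or an integer variable. For a variable $x$ of $\varphi$, let $U^\varphi_x=\{y\in\mathrm{Var}(\varphi)\mid x\le y \text{ occurs in }\varphi\}$ and let $C^\varphi_x$ be the set of ground terms $t$ such that the atom $x\le t$ occurs in $\varphi$. The sets $\mathcal{B}^\varphi_x$ ($x\in\mathrm{Var}(\varphi)$) are the smallest sets satisfying $\mathcal{B}^\varphi_x\supseteq C^\varphi_x\cup\bigcup_{y\in U^\varphi_x}\mathcal{B}^\varphi_y\cup\{\chi\}$ for all $x$, where $\chi$ is the special constant of the claim. -}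

module Defs where

open import Data.Nat using (ℕ)
open import Data.Integer using (ℤ; _≤_; _+_; -_) renaming (0ℤ to zeroℤ)
open import Data.Fin using (Fin)
open import Data.Vec using (Vec; []; _∷_)
import Data.Vec.Membership.Propositional as VecMem
open import Data.List using (List; map)
open import Data.List.Relation.Unary.All using (All)
open import Data.List.Relation.Unary.Any using (Any)
open import Data.List.Membership.Propositional using (_∈_)
open import Data.Product using (Σ; _×_; _,_; proj₁; proj₂)
open import Data.Sum using (_⊎_)
open import Data.Empty using (⊥; ⊥-elim)
open import Data.Unit using (⊤; tt)
open import Relation.Binary.PropositionalEquality using (_≡_)

-- A signature of additional function symbols of range ℤ (all arguments of sort ℤ).
record Sig : Set₁ where
  field
    Sym : Set
    ar  : Sym → ℕ
open Sig public

data GTm (S : Sig) : Set where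
  zero : GTm S
  neg  : GTm S → GTm S
  plus : GTm S → GTm S → GTm S
  app  : (f : Sym S) → Vec (GTm S) (ar S f) → GTm S

data _⊑_ {S : Sig} (t : GTm S) : GTm S → Set where
  here   : t ⊑ t
  inNeg  : ∀ {u} → t ⊑ u → t ⊑ neg u
  inPlusˡ : ∀ {u v} → t ⊑ u → t ⊑ plus u v
  inPlusʳ : ∀ {u v} → t ⊑ v → t ⊑ plus u v
  inApp  : ∀ {f ts u} → t ⊑ u → VecMem._∈_ u ts → t ⊑ app f ts

-- A ℤ-interpretation: ℤ, 0, -, +, ≤ are fixed; only the extra symbols are interpreted.
record Interp (S : Sig) : Set where
  field
    fun : (f : Sym S) → Vec ℤ (ar S f) → ℤ
open Interp public

mutual
  eval : {S : Sig} → Interp S → GTm S → ℤ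
  eval I zero       = zeroℤ
  eval I (neg t)    = - eval I t
  eval I (plus t u) = eval I t + eval I u
  eval I (app f ts) = fun I f (evalV I ts)

  evalV : {S : Sig} {k : ℕ} → Interp S → Vec (GTm S) k → Vec ℤ k
  evalV I []       = []
  evalV I (t ∷ ts) = eval I t ∷ evalV I ts

-- A side of an inequality atom: an integer variable among n, a ground term,
-- or one of the extra constants X (X = ⊥: none; X = ⊤: the single constant χ).
data Side (S : Sig) (n : ℕ) (X : Set) : Set where
  var : Fin n → Side S n X
  gnd : GTm S → Side S n X
  cst : X → Side S n X

Atom : Sig → ℕ → Set → Set
Atom S n X = Side S n X × Side S n X

-- Inequality formulas: conjunction (list) of atoms s ≤ t.
Formula : Sig → ℕ → Set → Set
Formula S n X = List (Atom S n X)

IneqFormula : Sig → ℕ → Set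
IneqFormula S n = Formula S n ⊥

evalSide : {S : Sig} {n : ℕ} {X : Set} → Interp S → (Fin n → ℤ) → (X → ℤ) → Side S n X → ℤ
evalSide I ρ κ (var i) = ρ i
evalSide I ρ κ (gnd t) = eval I t
evalSide I ρ κ (cst c) = κ c

Holds : {S : Sig} {n : ℕ} {X : Set} → Interp S → (Fin n → ℤ) → (X → ℤ) → Formula S n X → Set
Holds I ρ κ φ = All (λ a → evalSide I ρ κ (proj₁ a) ≤ evalSide I ρ κ (proj₂ a)) φ

AllVarsOccur : {S : Sig} {n : ℕ} → IneqFormula S n → Set
AllVarsOccur {n = n} φ = (i : Fin n) → Any (λ a → (proj₁ a ≡ var i) ⊎ (proj₂ a ≡ var i)) φ

OccursInSide : {S : Sig} {n : ℕ} {X : Set} → GTm S → Side S n X → Set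
OccursInSide t (var _) = ⊥
OccursInSide t (gnd u) = t ⊑ u
OccursInSide t (cst _) = ⊥

OccursIn : {S : Sig} {n : ℕ} → GTm S → IneqFormula S n → Set
OccursIn t φ = Any (λ a → OccursInSide t (proj₁ a) ⊎ OccursInSide t (proj₂ a)) φ

-- Ground terms of the signature extended by χ (gnd t) or χ itself (cst tt).
Cand : Sig → Set
Cand S = Side S 0 ⊤

χ : {S : Sig} → Cand S
χ = cst tt

-- The sets B^φ_x: smallest sets with B_x ⊇ C_x ∪ ⋃_{y ∈ U_x} B_y ∪ {χ}.
data B {S : Sig} {n : ℕ} (φ : IneqFormula S n) : Fin n → Cand S → Set where
  χ∈ : ∀ {x} → B φ x χ
  C∈ : ∀ {x t} → (var x , gnd t) ∈ φ → B φ x (gnd t)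
  U∈ : ∀ {x y s} → (var x , var y) ∈ φ → B φ y s → B φ x s

substSide : {S : Sig} {n : ℕ} → (Fin n → Cand S) → Side S n ⊥ → Cand S
substSide σ (var i) = σ i
substSide σ (gnd t) = gnd t
substSide σ (cst ())

subst : {S : Sig} {n : ℕ} → (Fin n → Cand S) → IneqFormula S n → Formula S 0 ⊤
subst σ φ = map (λ a → substSide σ (proj₁ a) , substSide σ (proj₂ a)) φ

SatAlpha : {S : Sig} {n : ℕ} → Interp S → IneqFormula S n → Set
SatAlpha {n = n} I φ = Σ (Fin n → ℤ) λ ρ → Holds I ρ ⊥-elim φ

-- (β) under the extension J of I with χ ↦ c:
-- some choice s_i ∈ B_{x_i} (i = 1..n) with J ⊨ φ{x_i ← s_i}.
SatBeta : {S : Sig} {n : ℕ} → Interp S → ℤ → IneqFormula S n → Set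
SatBeta {S} {n} I c φ =
  Σ (Fin n → Cand S) λ σ → ((i : Fin n) → B φ i (σ i)) × Holds I (λ ()) (λ _ → c) (subst σ φ)

-- Given a model ρ of φ, interpret χ by some c above every ground term of φ and replace each
-- x by the element of B_x of least value.  An atom x ≤ y then holds because B_y ⊆ B_x, and
-- x ≤ t because t ∈ B_x; for t ≤ x, every element of B_x is at least any common lower bound
-- of ρ(x) and c, by induction on B_x.  Conversely, a solution of (β) read as a valuation is a
-- model of φ.  The least element exists since B_x is finite: it consists of χ and the upper
-- bounds of the variables reachable from x along atoms x ≤ y, and this reachable set is
-- computed by saturating subsets of Fin n.
module Submission where

open import Defs
open import Data.Nat using (ℕ)
open import Data.Integer using (ℤ; _≤_)
open import Data.List using (List)
open import Data.List.Relation.Unary.All using (All)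
open import Data.List.Membership.Propositional using (_∈_)
open import Relation.Nullary using (¬_)
open import Function.Bundles using (_⇔_)

import Data.Nat as ℕ
import Data.Nat.Properties as ℕ
open import Data.Integer using (0ℤ) renaming (suc to sucℤ)
import Data.Integer.Properties as ℤ
open import Data.Fin using (Fin)
open import Data.Fin.Subset
  using (Subset; ⁅_⁆; _∪_; ∣_∣)
  renaming (_∈_ to _∈ₛ_; _⊆_ to _⊆ₛ_)
open import Data.Fin.Subset.Properties
  using (_∈?_; _⊂?_; x∈⁅x⁆; x∈⁅y⁆⇒x≡y; p⊆p∪q; q⊆p∪q; x∈p∪q⁻; ⊆⊤; ∣p∣≡n⇒p≡⊤; ∣p∣≤n; p⊂q⇒∣p∣<∣q∣)
open import Data.List using ([]; _∷_; map)
open import Data.List.Relation.Unary.All as All using ([]; _∷_)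
open import Data.List.Relation.Unary.All.Properties using (map⁺; map⁻)
import Data.List.Relation.Unary.Any as Any
open import Data.List.Relation.Unary.Any using (here; there)
open import Data.List.Membership.Propositional.Properties using (∈-map⁺)
open import Data.List.Extrema ℤ.≤-totalOrder
  using (argmin; argmin-all; f[argmin]≤f[⊤]; f[argmin]≤f[xs]; max; xs≤max)
open import Data.Product using (_,_; proj₁; proj₂)
open import Data.Sum using (inj₁; inj₂)
open import Data.Empty using (⊥; ⊥-elim)
open import Relation.Nullary using (yes; no; contradiction)
open import Relation.Unary using (Pred) renaming (_⊆_ to _⊆ₚ_)
open import Relation.Binary.PropositionalEquality using (_≡_; refl; sym; subst₂) renaming (subst to ≡-subst)
open import Function.Base using (_∘_)
open import Function.Bundles using (mk⇔)

module Saturation {n : ℕ} (f : Subset n → Subset n) (f-inflationary : ∀ {R} → R ⊆ₛ f R) where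

  saturate : ℕ → Subset n → Subset n
  saturate ℕ.zero    R = R
  saturate (ℕ.suc k) R with R ⊂? f R
  ... | yes _ = saturate k (f R)
  ... | no  _ = R

  ⊆-saturate : ∀ k {R} → R ⊆ₛ saturate k R
  ⊆-saturate ℕ.zero    x∈R = x∈R
  ⊆-saturate (ℕ.suc k) {R} x∈R with R ⊂? f R
  ... | yes _ = ⊆-saturate k (f-inflationary x∈R)
  ... | no  _ = x∈R

  saturate-preserves : ∀ {ℓ} (P : Pred (Fin n) ℓ) → (∀ {R} → (_∈ₛ R) ⊆ₚ P → (_∈ₛ f R) ⊆ₚ P) →
                       ∀ k {R} → (_∈ₛ R) ⊆ₚ P → (_∈ₛ saturate k R) ⊆ₚ P
  saturate-preserves P f-preserves ℕ.zero    R⊆P = R⊆P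
  saturate-preserves P f-preserves (ℕ.suc k) {R} R⊆P with R ⊂? f R
  ... | yes _ = saturate-preserves P f-preserves k (f-preserves R⊆P)
  ... | no  _ = R⊆P

  -- Each strict step adds an element, so n ≤ k + ∣ R ∣ steps suffice to reach a fixed point.
  saturate-closed : ∀ k R → n ℕ.≤ k ℕ.+ ∣ R ∣ → f (saturate k R) ⊆ₛ saturate k R
  saturate-closed ℕ.zero R n≤∣R∣ =
    ≡-subst (f R ⊆ₛ_) (sym (∣p∣≡n⇒p≡⊤ (ℕ.≤-antisym (∣p∣≤n R) n≤∣R∣))) ⊆⊤
  saturate-closed (ℕ.suc k) R n≤1+k+∣R∣ with R ⊂? f R
  ... | yes R⊂fR = saturate-closed k (f R) (ℕ.≤-trans n≤1+k+∣R∣ (begin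
          ℕ.suc (k ℕ.+ ∣ R ∣) ≡⟨ sym (ℕ.+-suc k ∣ R ∣) ⟩
          k ℕ.+ ℕ.suc ∣ R ∣   ≤⟨ ℕ.+-monoʳ-≤ k (p⊂q⇒∣p∣<∣q∣ R⊂fR) ⟩
          k ℕ.+ ∣ f R ∣       ∎))
    where open ℕ.≤-Reasoning
  ... | no R⊄fR = fR⊆R
    where
    fR⊆R : f R ⊆ₛ R
    fR⊆R {z} z∈fR with z ∈? R
    ... | yes z∈R = z∈R
    ... | no  z∉R = contradiction ((λ {x} → f-inflationary {R} {x}) , z , z∈fR , z∉R) R⊄fR

module _ {S : Sig} {n : ℕ} where

  Edge : IneqFormula S n → Fin n → Fin n → Set
  Edge L y z = (var y , var z) ∈ L

  extend : IneqFormula S n → Subset n → Subset n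
  extend [] R = R
  extend ((var y , var z) ∷ L) R with y ∈? R
  ... | yes _ = ⁅ z ⁆ ∪ extend L R
  ... | no  _ = extend L R
  extend (_ ∷ L) R = extend L R

  ⊆-extend : ∀ L {R} → R ⊆ₛ extend L R
  ⊆-extend []                    x∈R = x∈R
  ⊆-extend ((var y , var z) ∷ L) {R} x∈R with y ∈? R
  ... | yes _ = q⊆p∪q ⁅ z ⁆ (extend L R) (⊆-extend L x∈R)
  ... | no  _ = ⊆-extend L x∈R
  ⊆-extend ((var _ , gnd _) ∷ L) x∈R = ⊆-extend L x∈R
  ⊆-extend ((var _ , cst ()) ∷ L) x∈R
  ⊆-extend ((gnd _ , _) ∷ L)     x∈R = ⊆-extend L x∈R
  ⊆-extend ((cst () , _) ∷ L)    x∈R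

  extend-edge : ∀ L {R y z} → Edge L y z → y ∈ₛ R → z ∈ₛ extend L R
  extend-edge ((var y , var z) ∷ L) {R} e y′∈R with y ∈? R
  extend-edge ((var y , var z) ∷ L) {R} (here refl) y∈R  | yes _   = p⊆p∪q (extend L R) (x∈⁅x⁆ z)
  extend-edge ((var y , var z) ∷ L) {R} (there e)   y′∈R | yes _   =
    q⊆p∪q ⁅ z ⁆ (extend L R) (extend-edge L e y′∈R)
  extend-edge ((var y , var z) ∷ L)     (here refl) y∈R  | no y∉R  = contradiction y∈R y∉R
  extend-edge ((var y , var z) ∷ L)     (there e)   y′∈R | no _    = extend-edge L e y′∈R
  extend-edge ((var _ , gnd _) ∷ L) (there e) y∈R = extend-edge L e y∈R
  extend-edge ((var _ , cst ()) ∷ L) e y∈R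
  extend-edge ((gnd _ , _) ∷ L)     (there e) y∈R = extend-edge L e y∈R
  extend-edge ((cst () , _) ∷ L)    e y∈R

  extend-preserves : ∀ {ℓ} (P : Pred (Fin n) ℓ) L → (∀ {y z} → Edge L y z → P y → P z) →
                     ∀ {R} → (_∈ₛ R) ⊆ₚ P → (_∈ₛ extend L R) ⊆ₚ P
  extend-preserves P [] P-edge R⊆P = R⊆P
  extend-preserves P ((var y , var z) ∷ L) P-edge {R} R⊆P z′∈ with y ∈? R
  ... | no  _   = extend-preserves P L (P-edge ∘ there) R⊆P z′∈
  ... | yes y∈R with x∈p∪q⁻ ⁅ z ⁆ (extend L R) z′∈
  ...   | inj₁ z′∈⁅z⁆ = ≡-subst P (sym (x∈⁅y⁆⇒x≡y z z′∈⁅z⁆)) (P-edge (here refl) (R⊆P y∈R))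
  ...   | inj₂ z′∈ext = extend-preserves P L (P-edge ∘ there) R⊆P z′∈ext
  extend-preserves P ((var _ , gnd _) ∷ L) P-edge R⊆P = extend-preserves P L (P-edge ∘ there) R⊆P
  extend-preserves P ((var _ , cst ()) ∷ L) P-edge R⊆P
  extend-preserves P ((gnd _ , _) ∷ L)     P-edge R⊆P = extend-preserves P L (P-edge ∘ there) R⊆P
  extend-preserves P ((cst () , _) ∷ L)    P-edge R⊆P

  reachable : IneqFormula S n → Fin n → Subset n
  reachable φ x = saturate n ⁅ x ⁆
    where open Saturation (extend φ) (⊆-extend φ)

  module _ (φ : IneqFormula S n) (x : Fin n) where
    open Saturation (extend φ) (⊆-extend φ)

    x∈reachable : x ∈ₛ reachable φ x
    x∈reachable = ⊆-saturate n (x∈⁅x⁆ x)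

    reachable-closed : ∀ {y z} → Edge φ y z → y ∈ₛ reachable φ x → z ∈ₛ reachable φ x
    reachable-closed e y∈ = saturate-closed n ⁅ x ⁆ (ℕ.m≤m+n n _) (extend-edge φ e y∈)

    B-reachable : ∀ {y s} → y ∈ₛ reachable φ x → B φ y s → B φ x s
    B-reachable y∈ b =
      saturate-preserves B⊆Bx (extend-preserves B⊆Bx φ λ e Bz⊆Bx b′ → Bz⊆Bx (U∈ e b′)) n ⁅x⁆⊆B⊆Bx y∈ b
      where
      B⊆Bx : Pred (Fin n) _
      B⊆Bx y = ∀ {s} → B φ y s → B φ x s
      ⁅x⁆⊆B⊆Bx : (_∈ₛ ⁅ x ⁆) ⊆ₚ B⊆Bx
      ⁅x⁆⊆B⊆Bx y∈⁅x⁆ rewrite x∈⁅y⁆⇒x≡y x y∈⁅x⁆ = λ b → b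

  upperBounds : IneqFormula S n → Subset n → List (GTm S)
  upperBounds [] R = []
  upperBounds ((var y , gnd t) ∷ L) R with y ∈? R
  ... | yes _ = t ∷ upperBounds L R
  ... | no  _ = upperBounds L R
  upperBounds (_ ∷ L) R = upperBounds L R

  ∈-upperBounds : ∀ L {R y t} → (var y , gnd t) ∈ L → y ∈ₛ R → t ∈ upperBounds L R
  ∈-upperBounds ((var y , gnd t) ∷ L) {R} e y′∈R with y ∈? R
  ∈-upperBounds ((var y , gnd t) ∷ L) (here refl) y∈R  | yes _   = here refl
  ∈-upperBounds ((var y , gnd t) ∷ L) (there e)   y′∈R | yes _   = there (∈-upperBounds L e y′∈R)
  ∈-upperBounds ((var y , gnd t) ∷ L) (here refl) y∈R  | no y∉R  = contradiction y∈R y∉R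
  ∈-upperBounds ((var y , gnd t) ∷ L) (there e)   y′∈R | no _    = ∈-upperBounds L e y′∈R
  ∈-upperBounds ((var _ , var _) ∷ L) (there e) y∈R = ∈-upperBounds L e y∈R
  ∈-upperBounds ((var _ , cst ()) ∷ L) e y∈R
  ∈-upperBounds ((gnd _ , _) ∷ L)     (there e) y∈R = ∈-upperBounds L e y∈R
  ∈-upperBounds ((cst () , _) ∷ L)    e y∈R

  upperBounds-all : ∀ {ℓ} (P : Pred (GTm S) ℓ) L {R} →
                    (∀ {y t} → (var y , gnd t) ∈ L → y ∈ₛ R → P t) → All P (upperBounds L R)
  upperBounds-all P [] P-bound = []
  upperBounds-all P ((var y , gnd t) ∷ L) {R} P-bound with y ∈? R
  ... | yes y∈R = P-bound (here refl) y∈R ∷ upperBounds-all P L (P-bound ∘ there)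
  ... | no  _   = upperBounds-all P L (P-bound ∘ there)
  upperBounds-all P ((var _ , var _) ∷ L) P-bound = upperBounds-all P L (P-bound ∘ there)
  upperBounds-all P ((var _ , cst ()) ∷ L) P-bound
  upperBounds-all P ((gnd _ , _) ∷ L)     P-bound = upperBounds-all P L (P-bound ∘ there)
  upperBounds-all P ((cst () , _) ∷ L)    P-bound

  module Least (val : Cand S → ℤ) (φ : IneqFormula S n) where

    candidates : Fin n → List (Cand S)
    candidates x = map gnd (upperBounds φ (reachable φ x))

    least : Fin n → Cand S
    least x = argmin val χ (candidates x)

    least∈B : ∀ x → B φ x (least x)
    least∈B x = argmin-all val {P = B φ x} χ∈
      (map⁺ (upperBounds-all (B φ x ∘ gnd) φ λ e y∈ → B-reachable φ x y∈ (C∈ e)))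

    least-≤ : ∀ {x y s} → y ∈ₛ reachable φ x → B φ y s → val (least x) ≤ val s
    least-≤ {x} y∈ χ∈       = f[argmin]≤f[⊤] {f = val} χ (candidates x)
    least-≤ {x} y∈ (C∈ e)   = All.lookup (f[argmin]≤f[xs] {f = val} χ (candidates x))
                                (∈-map⁺ gnd (∈-upperBounds φ e y∈))
    least-≤ {x} y∈ (U∈ e b) = least-≤ (reachable-closed φ x e y∈) b

module _ {S : Sig} (I : Interp S) where

  strictUpperBound : List (GTm S) → ℤ
  strictUpperBound G = sucℤ (max 0ℤ (map (eval I) G))

  strictUpperBound-≰ : ∀ G → All (λ t → ¬ (strictUpperBound G ≤ eval I t)) G
  strictUpperBound-≰ G =
    All.map (λ t≤max → ℤ.<⇒≱ (ℤ.suc[i]≤j⇒i<j (ℤ.suc-mono t≤max))) (map⁻ (xs≤max 0ℤ (map (eval I) G)))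

  module _ {n : ℕ} (φ : IneqFormula S n) (c : ℤ) where

    value : Cand S → ℤ
    value = evalSide I (λ ()) (λ _ → c)

    open Least value φ

    evalSide-substSide : (τ : Fin n → Cand S) (a : Side S n ⊥) →
                         evalSide I (value ∘ τ) ⊥-elim a ≡ value (substSide τ a)
    evalSide-substSide τ (var i) = refl
    evalSide-substSide τ (gnd t) = refl
    evalSide-substSide τ (cst ())

    subst-holds⇒holds : (τ : Fin n → Cand S) →
                        Holds I (λ ()) (λ _ → c) (subst τ φ) → Holds I (value ∘ τ) ⊥-elim φ
    subst-holds⇒holds τ h = All.map (λ {a} → subst₂ _≤_ (sym (evalSide-substSide τ (proj₁ a)))
                                                  (sym (evalSide-substSide τ (proj₂ a))))
                              (map⁻ h)

    module _ {ρ : Fin n → ℤ} (ρ⊨φ : Holds I ρ ⊥-elim φ) where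

      B-lowerBound : ∀ {u x s} → u ≤ ρ x → u ≤ c → B φ x s → u ≤ value s
      B-lowerBound u≤ρx u≤c χ∈       = u≤c
      B-lowerBound u≤ρx u≤c (C∈ e)   = ℤ.≤-trans u≤ρx (All.lookup ρ⊨φ e)
      B-lowerBound u≤ρx u≤c (U∈ e b) = B-lowerBound (ℤ.≤-trans u≤ρx (All.lookup ρ⊨φ e)) u≤c b

      subst-least-holds : (∀ t → OccursIn t φ → eval I t ≤ c) → Holds I (λ ()) (λ _ → c) (subst least φ)
      subst-least-holds ground≤c = map⁺ (All.tabulate atom)
        where
        atom : ∀ {a} → a ∈ φ → value (substSide least (proj₁ a)) ≤ value (substSide least (proj₂ a))
        atom {var x , var y} e = least-≤ (x∈reachable φ x) (U∈ e (least∈B y))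
        atom {var x , gnd t} e = least-≤ (x∈reachable φ x) (C∈ e)
        atom {gnd t , var x} e =
          B-lowerBound (All.lookup ρ⊨φ e) (ground≤c t (Any.map (λ { refl → inj₁ here }) e)) (least∈B x)
        atom {gnd t , gnd u} e = All.lookup ρ⊨φ e
        atom {var _ , cst ()} e
        atom {gnd _ , cst ()} e
        atom {cst () , _}     e

theorem2 : (S : Sig) (n : ℕ) (φ : IneqFormula S n) → AllVarsOccur φ →
           (I : Interp S) (G : List (GTm S)) →
           ((t : GTm S) → OccursIn t φ → t ∈ G) →
           SatAlpha I φ ⇔ ((c : ℤ) → All (λ t → ¬ (c ≤ eval I t)) G → SatBeta I c φ)
theorem2 S n φ _ I G φ⊆G = mk⇔ forward backward
  where
  forward : SatAlpha I φ → ((c : ℤ) → All (λ t → ¬ (c ≤ eval I t)) G → SatBeta I c φ)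
  forward (ρ , ρ⊨φ) c c>G = least , least∈B , subst-least-holds I φ c ρ⊨φ ground≤c
    where
    open Least (value I φ c) φ
    ground≤c : ∀ t → OccursIn t φ → eval I t ≤ c
    ground≤c t t∈φ = ℤ.<⇒≤ (ℤ.≰⇒> (All.lookup c>G (φ⊆G t t∈φ)))
  backward : ((c : ℤ) → All (λ t → ¬ (c ≤ eval I t)) G → SatBeta I c φ) → SatAlpha I φ
  backward β =
    let c = strictUpperBound I G
        τ , _ , τ⊨φ = β c (strictUpperBound-≰ I G)
    in value I φ c ∘ τ , subst-holds⇒holds I φ c τ τ⊨φ
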